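{- Let $\mathfrak g$ be a mixed Lie algebra and $\tilde{\mathfrak g}=\mathfrak g/\pi\mathfrak g^+$ its reduced algebra (a quadratic Lie algebra). If $U=U_{\rm mix}(\mathfrak g)$, then $U_{\rm quad}(\tilde{\mathfrak g})=U/\pi U$.
   Context: A mixed Lie algebra is a graded Lie algebra $\mathfrak g=\bigoplus_{n\ge1}\mathfrak g_n$ over $\mathbb F_2$ with $P:\mathfrak g_n\to\mathfrak g_{n+1}$ satisfying, for homogeneous $\xi\in\mathfrak g_m,\eta\in\mathfrak g_n$: $P(\xi+\eta)=P\xi+P\eta+[\xi,\eta]$ if $m=n=1$, $=P\xi+P\eta$ if $m=n>1$; $[P\xi,\eta]=P[\xi,\eta]+[\xi,[\xi,\eta]]$ if $m=1$, $=P[\xi,\eta]$ if $m>1$. $\mathfrak g^+=\bigoplus_{n\ge2}\mathfrak g_n$, and $\pi\mathfrak g^+=P(\mathfrak g^+)$. $U_{\rm mix}(\mathfrak g)$ is the universal graded associative algebra $U$ over $\mathbb F_2[\pi]$ ($\pi$ of degree $1$) with a mixed Lie homomorphism $\mathfrak g\to U_+$, where $U_+$ has $[x,y]=xy+yx$, $P\xi=\pi\xi$ in degree $>1$, $P\xi=\pi\xi+\xi^2$ in degree $1$. A quadratic Lie algebra is a graded Lie algebra over $\mathbb F_2$ with $P:\mathfrak h_1\to\mathfrak h_2$ such that $P(\xi+\eta)=P\xi+P\eta+[\xi,\eta]$ and $[P\xi,\eta]=[\xi,[\xi,\eta]]$ for $\xi,\eta$ of degree $1$ ($\eta$ arbitrary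 homogeneous in the second); the induced $P$ on $\tilde{\mathfrak g}$ in degree $1$ makes it one. $U_{\rm quad}(\mathfrak h)$ is the universal graded associative $\mathbb F_2$-algebra $U$ with a quadratic Lie homomorphism $\mathfrak h\to U_+$, where $U_+$ has $[x,y]=xy+yx$ and $P(x)=x^2$ on $U_1$. -}

module Defs where

-- Quotients are modelled by
-- keeping the carrier and coarsening the equivalence relation (no quotient types).
-- A vector space over F₂ = abelian group in which every element is its own inverse.

open import Level using (0ℓ)
open import Data.Nat using (ℕ; zero; suc; _+_)
open import Data.Nat.Properties using (+-assoc; +-comm; +-suc; +-identityʳ)
open import Data.Product using (Σ; _×_)
open import Relation.Binary.PropositionalEquality using (_≡_; refl; subst; cong; sym; trans)
open import Algebra.Structures using (IsAbelianGroup)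

cast : {A : ℕ → Set} {m n : ℕ} → m ≡ n → A m → A n
cast {A} = subst A

jac₁ : ∀ l m n → suc (m + suc (n + l)) ≡ suc (l + suc (m + n))
jac₁ l m n = cong suc (begin
    m + suc (n + l)     ≡⟨ +-suc m (n + l) ⟩
    suc (m + (n + l))   ≡⟨ cong suc (sym (+-assoc m n l)) ⟩
    suc ((m + n) + l)   ≡⟨ cong suc (+-comm (m + n) l) ⟩
    suc (l + (m + n))   ≡⟨ sym (+-suc l (m + n)) ⟩
    l + suc (m + n)     ∎)
  where open Relation.Binary.PropositionalEquality.≡-Reasoning

jac₂ : ∀ l m n → suc (n + suc (l + m)) ≡ suc (l + suc (m + n))
jac₂ l m n = cong suc (begin
    n + suc (l + m)     ≡⟨ +-suc n (l + m) ⟩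
    suc (n + (l + m))   ≡⟨ cong suc (+-comm n (l + m)) ⟩
    suc ((l + m) + n)   ≡⟨ cong suc (+-assoc l m n) ⟩
    suc (l + (m + n))   ≡⟨ sym (+-suc l (m + n)) ⟩
    l + suc (m + n)     ∎)
  where open Relation.Binary.PropositionalEquality.≡-Reasoning

prod₁ : ∀ m n → suc (m + suc n) ≡ suc (suc (m + n))
prod₁ m n = cong suc (+-suc m n)

prod₂ : ∀ m n → suc (n + suc m) ≡ suc (suc (m + n))
prod₂ m n = cong suc (trans (+-suc n m) (cong suc (+-comm n m)))

-- Graded Lie algebras over F₂.  Component  L k  is the degree (k+1) part,
-- so g = ⊕_{n ≥ 1} g_n.  [g_{m+1}, g_{n+1}] ⊆ g_{m+n+2}.

record RawLie : Set₁ where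
  field
    L     : ℕ → Set
    _≈_   : ∀ {k} → L k → L k → Set
    _⊕_   : ∀ {k} → L k → L k → L k
    0#    : ∀ {k} → L k
    [_,_] : ∀ {m n} → L m → L n → L (suc (m + n))

record IsGradedLie (g : RawLie) : Set where
  open RawLie g
  field
    isVecF₂    : ∀ k → IsAbelianGroup (_≈_ {k}) _⊕_ 0# (λ x → x)
    br-cong    : ∀ {m n} {x x' : L m} {y y' : L n} → x ≈ x' → y ≈ y' → [ x , y ] ≈ [ x' , y' ]
    br-distribˡ : ∀ {m n} (x y : L m) (z : L n) → [ x ⊕ y , z ] ≈ ([ x , z ] ⊕ [ y , z ])
    br-distribʳ : ∀ {m n} (x : L m) (y z : L n) → [ x , y ⊕ z ] ≈ ([ x , y ] ⊕ [ x , z ])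
    br-alt     : ∀ {m} (x : L m) → [ x , x ] ≈ 0#
    br-comm    : ∀ {m n} (x : L m) (y : L n) →
                 cast {L} (cong suc (+-comm m n)) [ x , y ] ≈ [ y , x ]
    jacobi     : ∀ {l m n} (x : L l) (y : L m) (z : L n) →
                 (([ x , [ y , z ] ] ⊕ cast {L} (jac₁ l m n) [ y , [ z , x ] ])
                   ⊕ cast {L} (jac₂ l m n) [ z , [ x , y ] ]) ≈ 0#

record RawMixed : Set₁ where
  field
    raw : RawLie
  open RawLie raw public
  field
    P : ∀ {k} → L k → L (suc k)

record IsMixedLie (g : RawMixed) : Set where
  open RawMixed g
  field
    isGradedLie : IsGradedLie raw
    P-cong  : ∀ {k} {x y : L k} → x ≈ y → P x ≈ P y
    P-add₁  : ∀ (x y : L 0) → P (x ⊕ y) ≈ ((P x ⊕ P y) ⊕ [ x , y ])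
    P-add>₁ : ∀ {k} (x y : L (suc k)) → P (x ⊕ y) ≈ (P x ⊕ P y)
    P-br₁   : ∀ {n} (x : L 0) (y : L n) → [ P x , y ] ≈ (P [ x , y ] ⊕ [ x , [ x , y ] ])
    P-br>₁  : ∀ {m n} (x : L (suc m)) (y : L n) → [ P x , y ] ≈ P [ x , y ]

record MixedLie : Set₁ where
  field
    rawMixed   : RawMixed
    isMixedLie : IsMixedLie rawMixed
  open RawMixed rawMixed public

record RawQuad : Set₁ where
  field
    raw : RawLie
  open RawLie raw public
  field
    P : L 0 → L 1

record IsQuadLie (h : RawQuad) : Set where
  open RawQuad h
  field
    isGradedLie : IsGradedLie raw
    P-cong : ∀ {x y : L 0} → x ≈ y → P x ≈ P y
    P-add  : ∀ (x y : L 0) → P (x ⊕ y) ≈ ((P x ⊕ P y) ⊕ [ x , y ])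
    P-br   : ∀ {n} (x : L 0) (y : L n) → [ P x , y ] ≈ [ x , [ x , y ] ]

-- Graded (unital) associative algebras over F₂.  Component  A n  is degree n ≥ 0.

record RawGAlg : Set₁ where
  field
    A   : ℕ → Set
    _≈_ : ∀ {n} → A n → A n → Set
    _⊕_ : ∀ {n} → A n → A n → A n
    0#  : ∀ {n} → A n
    _*_ : ∀ {m n} → A m → A n → A (m + n)
    1#  : A 0

record IsGAlg (U : RawGAlg) : Set where
  open RawGAlg U
  field
    isVecF₂   : ∀ n → IsAbelianGroup (_≈_ {n}) _⊕_ 0# (λ x → x)
    *-cong    : ∀ {m n} {x x' : A m} {y y' : A n} → x ≈ x' → y ≈ y' → (x * y) ≈ (x' * y')
    *-assoc   : ∀ {l m n} (x : A l) (y : A m) (z : A n) →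
                cast {A} (+-assoc l m n) ((x * y) * z) ≈ (x * (y * z))
    *-distribˡ : ∀ {m n} (x : A m) (y z : A n) → (x * (y ⊕ z)) ≈ ((x * y) ⊕ (x * z))
    *-distribʳ : ∀ {m n} (x y : A m) (z : A n) → ((x ⊕ y) * z) ≈ ((x * z) ⊕ (y * z))
    *-identityˡ : ∀ {n} (x : A n) → (1# * x) ≈ x
    *-identityʳ : ∀ {n} (x : A n) → cast {A} (+-identityʳ n) (x * 1#) ≈ x

record GAlg : Set₁ where
  field
    raw    : RawGAlg
    isGAlg : IsGAlg raw
  open RawGAlg raw public

record πGAlg : Set₁ where
  field
    raw    : RawGAlg
    isGAlg : IsGAlg raw
  open RawGAlg raw public
  field
    π         : A 1
    π-central : ∀ {n} (x : A n) → cast {A} (+-comm n 1) (x * π) ≈ (π * x)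

record IsGAlgHom (U V : RawGAlg) (φ : ∀ {n} → RawGAlg.A U n → RawGAlg.A V n) : Set where
  private module U = RawGAlg U
  private module V = RawGAlg V
  field
    φ-cong : ∀ {n} {x y : U.A n} → x U.≈ y → φ x V.≈ φ y
    φ-+    : ∀ {n} (x y : U.A n) → φ (x U.⊕ y) V.≈ (φ x V.⊕ φ y)
    φ-*    : ∀ {m n} (x : U.A m) (y : U.A n) → φ (x U.* y) V.≈ (φ x V.* φ y)
    φ-1    : φ U.1# V.≈ V.1#

record IsπGAlgHom (U V : πGAlg) (φ : ∀ {n} → πGAlg.A U n → πGAlg.A V n) : Set where
  field
    isGAlgHom : IsGAlgHom (πGAlg.raw U) (πGAlg.raw V) φ
    φ-π       : πGAlg._≈_ V (φ (πGAlg.π U)) (πGAlg.π V)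

-- Mixed Lie homomorphism  g → U₊  (U over F₂[π]); U₊ = ⊕_{n≥1} U_n,
-- [x,y] = xy + yx,  Pξ = πξ in degree > 1,  Pξ = πξ + ξ² in degree 1.

record IsMixedHom (g : RawMixed) (U : πGAlg) (f : ∀ {k} → RawMixed.L g k → πGAlg.A U (suc k)) : Set where
  private module g = RawMixed g
  open πGAlg U
  field
    f-cong : ∀ {k} {x y : g.L k} → x g.≈ y → f x ≈ f y
    f-+    : ∀ {k} (x y : g.L k) → f (x g.⊕ y) ≈ (f x ⊕ f y)
    f-br   : ∀ {m n} (x : g.L m) (y : g.L n) →
             f g.[ x , y ] ≈ (cast {A} (prod₁ m n) (f x * f y) ⊕ cast {A} (prod₂ m n) (f y * f x))
    f-P₁   : ∀ (x : g.L 0) → f (g.P x) ≈ ((π * f x) ⊕ (f x * f x))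
    f-P>₁  : ∀ {k} (x : g.L (suc k)) → f (g.P x) ≈ (π * f x)

record IsQuadHom (h : RawQuad) (U : RawGAlg) (f : ∀ {k} → RawQuad.L h k → RawGAlg.A U (suc k)) : Set where
  private module h = RawQuad h
  open RawGAlg U
  field
    f-cong : ∀ {k} {x y : h.L k} → x h.≈ y → f x ≈ f y
    f-+    : ∀ {k} (x y : h.L k) → f (x h.⊕ y) ≈ (f x ⊕ f y)
    f-br   : ∀ {m n} (x : h.L m) (y : h.L n) →
             f h.[ x , y ] ≈ (cast {A} (prod₁ m n) (f x * f y) ⊕ cast {A} (prod₂ m n) (f y * f x))
    f-P    : ∀ (x : h.L 0) → f (h.P x) ≈ (f x * f x)

record IsUmix (g : RawMixed) (U : πGAlg) (ι : ∀ {k} → RawMixed.L g k → πGAlg.A U (suc k)) : Set₁ where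
  field
    ι-hom     : IsMixedHom g U ι
    universal : ∀ (V : πGAlg) (f : ∀ {k} → RawMixed.L g k → πGAlg.A V (suc k)) →
                IsMixedHom g V f →
                Σ (∀ {n} → πGAlg.A U n → πGAlg.A V n) λ φ →
                  IsπGAlgHom U V φ
                  × (∀ {k} (x : RawMixed.L g k) → πGAlg._≈_ V (φ (ι x)) (f x))
                  × (∀ (ψ : ∀ {n} → πGAlg.A U n → πGAlg.A V n) → IsπGAlgHom U V ψ →
                       (∀ {k} (x : RawMixed.L g k) → πGAlg._≈_ V (ψ (ι x)) (f x)) →
                       ∀ {n} (u : πGAlg.A U n) → πGAlg._≈_ V (ψ u) (φ u))

record IsUquad (h : RawQuad) (U : RawGAlg) (ι : ∀ {k} → RawQuad.L h k → RawGAlg.A U (suc k)) : Set₁ where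
  field
    ι-hom     : IsQuadHom h U ι
    universal : ∀ (V : GAlg) (f : ∀ {k} → RawQuad.L h k → GAlg.A V (suc k)) →
                IsQuadHom h (GAlg.raw V) f →
                Σ (∀ {n} → RawGAlg.A U n → GAlg.A V n) λ φ →
                  IsGAlgHom U (GAlg.raw V) φ
                  × (∀ {k} (x : RawQuad.L h k) → GAlg._≈_ V (φ (ι x)) (f x))
                  × (∀ (ψ : ∀ {n} → RawGAlg.A U n → GAlg.A V n) → IsGAlgHom U (GAlg.raw V) ψ →
                       (∀ {k} (x : RawQuad.L h k) → GAlg._≈_ V (ψ (ι x)) (f x)) →
                       ∀ {n} (u : RawGAlg.A U n) → GAlg._≈_ V (ψ u) (φ u))

-- reduced algebra  g̃ = g / π g⁺ ,  π g⁺ = P(⊕_{n≥2} g_n) ⊆ ⊕_{n≥3} g_n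
reducedRel : (g : MixedLie) → ∀ {k} → MixedLie.L g k → MixedLie.L g k → Set
reducedRel g {zero}  x y = MixedLie._≈_ g x y
reducedRel g {suc zero} x y = MixedLie._≈_ g x y
reducedRel g {suc (suc j)} x y =
  Σ (MixedLie.L g (suc j)) λ z → MixedLie._≈_ g (MixedLie._⊕_ g x y) (MixedLie.P g z)

reduced : MixedLie → RawQuad
reduced g = record
  { raw = record
      { L = MixedLie.L g
      ; _≈_ = reducedRel g
      ; _⊕_ = MixedLie._⊕_ g
      ; 0# = MixedLie.0# g
      ; [_,_] = MixedLie.[_,_] g
      }
  ; P = MixedLie.P g {0}
  }

-- U / πU  (πU in degree n+1 is π·U_n), as an algebra over F₂
modπRel : (U : πGAlg) → ∀ {n} → πGAlg.A U n → πGAlg.A U n → Set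
modπRel U {zero}  x y = πGAlg._≈_ U x y
modπRel U {suc n} x y =
  Σ (πGAlg.A U n) λ z → πGAlg._≈_ U (πGAlg._⊕_ U x y) (πGAlg._*_ U (πGAlg.π U) z)

modπ : πGAlg → RawGAlg
modπ U = record
  { A = πGAlg.A U
  ; _≈_ = modπRel U
  ; _⊕_ = πGAlg._⊕_ U
  ; 0# = πGAlg.0# U
  ; _*_ = πGAlg._*_ U
  ; 1# = πGAlg.1# U
  }

module Submission where

-- Both quotients coarsen an F₂-vector space by "x ~ y iff x + y lies in the
-- image of a linear map": P restricted to g⁺ for g̃, left multiplication by π
-- for U/πU.  The image of P on g⁺ is a Lie
-- ideal ([Pz,y] = P[z,y] for deg z ≥ 2) and πU is a two-sided ideal (π is
-- central), so bracket and product descend; the quadratic law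
-- [Pξ,η] = [ξ,[ξ,η]] is the mixed law modulo P[ξ,η] ∈ πg⁺.  For the universal property, a graded F₂-algebra V
-- is an F₂[π]-algebra with π acting as 0; then quadratic homomorphisms
-- g̃ → V₊ are mixed homomorphisms g → V₊, and algebra maps U/πU → V are the
-- F₂[π]-algebra maps U → V, so the universal property of U transfers.

open import Defs
open import Level using (0ℓ)
open import Data.Nat using (ℕ; zero; suc; _+_)
open import Data.Nat.Properties using (+-comm; +-suc)
open import Data.Product using (Σ; _×_; _,_)
open import Relation.Binary.PropositionalEquality as ≡ using (_≡_)
open import Relation.Binary.Structures using (IsEquivalence)
open import Algebra.Bundles using (AbelianGroup)
open import Algebra.Structures using (IsAbelianGroup)
import Algebra.Properties.Group as GroupProperties
import Algebra.Properties.CommutativeSemigroup as CommutativeSemigroupProperties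
import Relation.Binary.Reasoning.Setoid as SetoidReasoning

module F₂Space {A : Set} {_≈_ : A → A → Set} {_⊕_ : A → A → A} {0# : A}
                (isF₂Space : IsAbelianGroup _≈_ _⊕_ 0# (λ x → x)) where
  open IsAbelianGroup isF₂Space public
  private
    abelianGroup : AbelianGroup 0ℓ 0ℓ
    abelianGroup = record { isAbelianGroup = isF₂Space }
  open AbelianGroup abelianGroup using (group; commutativeSemigroup)
  open GroupProperties group using (x∙y⁻¹≈ε⇒x≈y; x≈y⇒x∙y⁻¹≈ε; identityʳ-unique)
  open CommutativeSemigroupProperties commutativeSemigroup public using (interchange)
  open SetoidReasoning setoid

  sum≈0⇒≈ : ∀ {x y} → (x ⊕ y) ≈ 0# → x ≈ y
  sum≈0⇒≈ {x} {y} = x∙y⁻¹≈ε⇒x≈y x y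

  ≈⇒sum≈0 : ∀ {x y} → x ≈ y → (x ⊕ y) ≈ 0#
  ≈⇒sum≈0 = x≈y⇒x∙y⁻¹≈ε

  double⇒0 : ∀ {x} → x ≈ (x ⊕ x) → x ≈ 0#
  double⇒0 {x} e = identityʳ-unique x x (sym e)

  sum-telescopes : ∀ x y w → ((x ⊕ y) ⊕ (y ⊕ w)) ≈ (x ⊕ w)
  sum-telescopes x y w = begin
    (x ⊕ y) ⊕ (y ⊕ w)  ≈⟨ assoc x y (y ⊕ w) ⟩
    x ⊕ (y ⊕ (y ⊕ w))  ≈⟨ ∙-congˡ (assoc y y w) ⟨
    x ⊕ ((y ⊕ y) ⊕ w)  ≈⟨ ∙-congˡ (∙-congʳ (inverseʳ y)) ⟩
    x ⊕ (0# ⊕ w)       ≈⟨ ∙-congˡ (identityˡ w) ⟩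
    x ⊕ w              ∎

  move-summand : ∀ {a b c} → a ≈ (b ⊕ c) → (a ⊕ c) ≈ b
  move-summand {a} {b} {c} e = begin
    a ⊕ c        ≈⟨ ∙-congʳ e ⟩
    (b ⊕ c) ⊕ c  ≈⟨ assoc b c c ⟩
    b ⊕ (c ⊕ c)  ≈⟨ ∙-congˡ (inverseʳ c) ⟩
    b ⊕ 0#       ≈⟨ identityʳ b ⟩
    b            ∎

record IsCoarsening {A : Set} (_≈_ : A → A → Set) (_⊕_ : A → A → A)
                    (R : A → A → Set) : Set where
  field
    isEquivalence : IsEquivalence R
    refines       : ∀ {x y} → x ≈ y → R x y
    ⊕-cong        : ∀ {x x' y y'} → R x x' → R y y' → R (x ⊕ y) (x' ⊕ y')
  open IsEquivalence isEquivalence public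

-- A coarsening of an F₂-space is again an F₂-space: every law is an
-- ≈-equation, hence an R-equation.
coarsen : {A : Set} {_≈_ : A → A → Set} {_⊕_ : A → A → A} {0# : A} {R : A → A → Set} →
          IsAbelianGroup _≈_ _⊕_ 0# (λ x → x) → IsCoarsening _≈_ _⊕_ R →
          IsAbelianGroup R _⊕_ 0# (λ x → x)
coarsen space coarsening = record
  { isGroup = record
    { isMonoid = record
      { isSemigroup = record
        { isMagma = record { isEquivalence = C.isEquivalence ; ∙-cong = C.⊕-cong }
        ; assoc = λ x y z → C.refines (S.assoc x y z) }
      ; identity = (λ x → C.refines (S.identityˡ x)) , (λ x → C.refines (S.identityʳ x)) }
    ; inverse = (λ x → C.refines (S.inverseˡ x)) , (λ x → C.refines (S.inverseʳ x))
    ; ⁻¹-cong = λ e → e }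
  ; comm = λ x y → C.refines (S.comm x y) }
  where
  module S = IsAbelianGroup space
  module C = IsCoarsening coarsening

equality-coarsening : {A : Set} {_≈_ : A → A → Set} {_⊕_ : A → A → A} {0# : A} →
                      IsAbelianGroup _≈_ _⊕_ 0# (λ x → x) → IsCoarsening _≈_ _⊕_ _≈_
equality-coarsening space = record
  { isEquivalence = isEquivalence ; refines = λ e → e ; ⊕-cong = ∙-cong }
  where open IsAbelianGroup space

-- A linear map h : B → A between F₂-spaces.  It preserves 0, and
-- "x + y ∈ im h" is a coarsening of A (the quotient A / im h).
module LinearMap
  {B : Set} {_≈ᴮ_ : B → B → Set} {_⊕ᴮ_ : B → B → B} {0ᴮ : B}
  {A : Set} {_≈_ : A → A → Set} {_⊕_ : A → A → A} {0# : A}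
  (source : IsAbelianGroup _≈ᴮ_ _⊕ᴮ_ 0ᴮ (λ x → x))
  (target : IsAbelianGroup _≈_ _⊕_ 0# (λ x → x))
  (h : B → A)
  (h-cong : ∀ {x y} → x ≈ᴮ y → h x ≈ h y)
  (h-⊕ : ∀ x y → h (x ⊕ᴮ y) ≈ (h x ⊕ h y))
  where
  private
    module Sᴮ = IsAbelianGroup source
  open F₂Space target

  h-0 : h 0ᴮ ≈ 0#
  h-0 = double⇒0 (trans (h-cong (Sᴮ.sym (Sᴮ.identityˡ 0ᴮ))) (h-⊕ 0ᴮ 0ᴮ))

  ModImage : A → A → Set
  ModImage x y = Σ B λ z → (x ⊕ y) ≈ h z

  image-coarsening : IsCoarsening _≈_ _⊕_ ModImage
  image-coarsening = record
    { isEquivalence = record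
      { refl  = λ {x} → 0ᴮ , trans (≈⇒sum≈0 refl) (sym h-0)
      ; sym   = λ { {x} {y} (z , e) → z , trans (comm y x) e }
      ; trans = λ { {x} {y} {w} (z , e) (z' , e') →
                    (z ⊕ᴮ z') , trans (sym (sum-telescopes x y w))
                                      (trans (∙-cong e e') (sym (h-⊕ z z'))) } }
    ; refines = λ {x} {y} e → 0ᴮ , trans (≈⇒sum≈0 e) (sym h-0)
    ; ⊕-cong = λ { {x} {x'} {y} {y'} (z , e) (z' , e') →
                   (z ⊕ᴮ z') , trans (interchange x y x' y')
                                     (trans (∙-cong e e') (sym (h-⊕ z z'))) } }

module Reduced (g : MixedLie) where
  open MixedLie g
  open IsMixedLie isMixedLie
  open IsGradedLie isGradedLie
  private
    module Space {k} = F₂Space (isVecF₂ k)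

  -- P is linear on g⁺ = ⊕_{n ≥ 2} g_n, and g̃ is g modulo its image there.
  module P⁺ (j : ℕ) = LinearMap (isVecF₂ (suc j)) (isVecF₂ (suc (suc j))) P P-cong P-add>₁

  coarsening : ∀ k → IsCoarsening _≈_ _⊕_ (reducedRel g {k})
  coarsening zero          = equality-coarsening (isVecF₂ 0)
  coarsening (suc zero)    = equality-coarsening (isVecF₂ 1)
  coarsening (suc (suc j)) = P⁺.image-coarsening j

  private
    module R {k} = IsCoarsening (coarsening k)

  _~_ : ∀ {k} → L k → L k → Set
  _~_ = reducedRel g

  ~-cast : ∀ {k k'} (p : k ≡ k') {a b : L k} → a ~ b → cast {L} p a ~ cast {L} p b
  ~-cast ≡.refl e = e

  -- πg⁺ is a Lie ideal, since [Pz, y] = P[z, y] for z ∈ g⁺.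
  bracketˡ-cong : ∀ {m n} {x x' : L m} (y : L n) → x ~ x' → [ x , y ] ~ [ x' , y ]
  bracketˡ-cong {zero}        {n} y e = R.refines (br-cong e (Space.refl {n}))
  bracketˡ-cong {suc zero}    {n} y e = R.refines (br-cong e (Space.refl {n}))
  bracketˡ-cong {suc (suc j)} {n} {x} {x'} y (z , e) = [ z , y ] , (begin
      [ x , y ] ⊕ [ x' , y ]  ≈⟨ br-distribˡ x x' y ⟨
      [ x ⊕ x' , y ]          ≈⟨ br-cong e Space.refl ⟩
      [ P z , y ]             ≈⟨ P-br>₁ z y ⟩
      P [ z , y ]             ∎)
    where open SetoidReasoning (Space.setoid {suc (suc (suc j) + n)})

  -- the right-hand version follows by antisymmetry of the bracket
  bracketʳ-cong : ∀ {m n} (x : L m) {y y' : L n} → y ~ y' → [ x , y ] ~ [ x , y' ]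
  bracketʳ-cong {m} {n} x {y} {y'} e =
    R.trans {suc (m + n)} (R.refines (Space.sym (br-comm y x)))
      (R.trans {suc (m + n)} (~-cast swap (bracketˡ-cong {n} {m} x e)) (R.refines (br-comm y' x)))
    where
    swap : suc (n + m) ≡ suc (m + n)
    swap = ≡.cong suc (+-comm n m)

  isQuadLie : IsQuadLie (reduced g)
  isQuadLie = record
    { isGradedLie = record
      { isVecF₂     = λ k → coarsen (isVecF₂ k) (coarsening k)
      ; br-cong     = λ {m} {n} {x} {x'} {y} e e' →
                        R.trans {suc (m + n)} (bracketˡ-cong {m} {n} y e) (bracketʳ-cong x' e')
      ; br-distribˡ = λ x y z → R.refines (br-distribˡ x y z)
      ; br-distribʳ = λ x y z → R.refines (br-distribʳ x y z)
      ; br-alt      = λ x → R.refines (br-alt x)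
      ; br-comm     = λ x y → R.refines (br-comm x y)
      ; jacobi      = λ x y z → R.refines (jacobi x y z) }
    ; P-cong = P-cong
    ; P-add  = P-add₁
      -- [Pξ, η] + [ξ, [ξ, η]] = P[ξ, η] lies in πg⁺
    ; P-br   = λ x y → [ x , y ] , Space.move-summand (P-br₁ x y) }

module GradedAlgebra (U : RawGAlg) (isGAlg : IsGAlg U) where
  open RawGAlg U
  open IsGAlg isGAlg
  private
    module Space {k} = F₂Space (isVecF₂ k)

  zero-* : ∀ {m n} (a : A n) → (0# {m} * a) ≈ 0#
  zero-* {m} a = LinearMap.h-0 (isVecF₂ m) (isVecF₂ _) (_* a)
                   (λ e → *-cong e Space.refl) (λ x y → *-distribʳ x y a)

  *-zero : ∀ {m n} (a : A m) → (a * 0# {n}) ≈ 0#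
  *-zero {n = n} a = LinearMap.h-0 (isVecF₂ n) (isVecF₂ _) (a *_) (*-cong Space.refl) (*-distribˡ a)

  _≋_ : ∀ {m n} → A m → A n → Set
  _≋_ {m} {n} a b = Σ (m ≡ n) λ p → cast {A} p a ≈ b

  ≈⇒≋ : ∀ {n} {a b : A n} → a ≈ b → a ≋ b
  ≈⇒≋ e = ≡.refl , e

  ≋-sym : ∀ {m n} {a : A m} {b : A n} → a ≋ b → b ≋ a
  ≋-sym (≡.refl , e) = ≡.refl , Space.sym e

  ≋-trans : ∀ {l m n} {a : A l} {b : A m} {c : A n} → a ≋ b → b ≋ c → a ≋ c
  ≋-trans (≡.refl , e) (≡.refl , e') = ≡.refl , Space.trans e e'

  ≋-*ˡ : ∀ {l m n} {a : A l} {a' : A m} (c : A n) → a ≋ a' → (a * c) ≋ (a' * c)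
  ≋-*ˡ c (≡.refl , e) = ≡.refl , *-cong e Space.refl

  0≋0 : ∀ {m n} → m ≡ n → 0# {m} ≋ 0# {n}
  0≋0 ≡.refl = ≡.refl , Space.refl

  -- degree equations are proof-irrelevant, so ≋ holds along any of them
  ≋⇒cast : ∀ {m n} {a : A m} {b : A n} → a ≋ b → (p : m ≡ n) → cast {A} p a ≈ b
  ≋⇒cast (≡.refl , e) ≡.refl = e

module ModPi (U : πGAlg) where
  open πGAlg U
  open IsGAlg isGAlg
  open GradedAlgebra raw isGAlg
  private
    module Space {k} = F₂Space (isVecF₂ k)

  module π· (n : ℕ) = LinearMap (isVecF₂ n) (isVecF₂ (suc n)) (π *_) (*-cong Space.refl) (*-distribˡ π)

  coarsening : ∀ k → IsCoarsening _≈_ _⊕_ (modπRel U {k})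
  coarsening zero    = equality-coarsening (isVecF₂ 0)
  coarsening (suc n) = π·.image-coarsening n

  private
    module R {k} = IsCoarsening (coarsening k)

  _~_ : ∀ {k} → A k → A k → Set
  _~_ = modπRel U

  sum∈πU : ∀ {k n} (p : k ≡ suc n) {a b : A k} (z : A n) → cast {A} p (a ⊕ b) ≈ (π * z) → a ~ b
  sum∈πU ≡.refl z e = z , e

  -- π is central, so it slides out of a right factor
  π-slides : ∀ {m n} (x : A m) (w : A n) → (x * (π * w)) ≋ (π * (x * w))
  π-slides x w =
    ≋-trans (≋-sym (_ , *-assoc x π w))
      (≋-trans (≋-*ˡ w (_ , π-central x)) (_ , *-assoc π x w))

  *ˡ-cong : ∀ {m n} {x x' : A m} (y : A n) → x ~ x' → (x * y) ~ (x' * y)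
  *ˡ-cong {zero}  {n} y e = R.refines (*-cong e (Space.refl {n}))
  *ˡ-cong {suc m} {n} {x} {x'} y (z , e) = (z * y) , (begin
      (x * y) ⊕ (x' * y)  ≈⟨ *-distribʳ x x' y ⟨
      (x ⊕ x') * y        ≈⟨ *-cong e Space.refl ⟩
      (π * z) * y         ≈⟨ *-assoc π z y ⟩
      π * (z * y)         ∎)
    where open SetoidReasoning (Space.setoid {suc (m + n)})

  *ʳ-cong : ∀ {m n} (x : A m) {y y' : A n} → y ~ y' → (x * y) ~ (x * y')
  *ʳ-cong {m} {zero}  x e = R.refines (*-cong (Space.refl {m}) e)
  *ʳ-cong {m} {suc n} x {y} {y'} (w , e) =
    sum∈πU (+-suc m n) (x * w) (≋⇒cast (≋-trans (≈⇒≋ sum-factors) (π-slides x w)) (+-suc m n))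
    where
    sum-factors : ((x * y) ⊕ (x * y')) ≈ (x * (π * w))
    sum-factors = Space.trans (Space.sym (*-distribˡ x y y')) (*-cong Space.refl e)

  isGAlgModπ : IsGAlg (modπ U)
  isGAlgModπ = record
    { isVecF₂     = λ k → coarsen (isVecF₂ k) (coarsening k)
    ; *-cong      = λ {m} {n} {x} {x'} {y} e e' →
                      R.trans {m + n} (*ˡ-cong {m} {n} y e) (*ʳ-cong x' e')
    ; *-assoc     = λ x y z → R.refines (*-assoc x y z)
    ; *-distribˡ  = λ x y z → R.refines (*-distribˡ x y z)
    ; *-distribʳ  = λ x y z → R.refines (*-distribʳ x y z)
    ; *-identityˡ = λ x → R.refines (*-identityˡ x)
    ; *-identityʳ = λ x → R.refines (*-identityʳ x) }

πAsZero : GAlg → πGAlg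
πAsZero V = record
  { raw = raw ; isGAlg = isGAlg ; π = 0#
  ; π-central = λ {n} x → ≋⇒cast (≋-trans (≈⇒≋ (*-zero x))
                                    (≋-trans (0≋0 (+-comm n 1)) (≈⇒≋ (Space.sym (zero-* x)))))
                                  (+-comm n 1) }
  where
  open GAlg V
  open GradedAlgebra raw isGAlg
  module Space {k} = F₂Space (IsGAlg.isVecF₂ isGAlg k)

module LieHomomorphisms (g : MixedLie) where
  open MixedLie g
  open IsMixedLie isMixedLie

  -- a mixed homomorphism g → U₊ is a quadratic homomorphism g̃ → (U/πU)₊:
  -- it sends πg⁺ into πU, and f(Pξ) = πf(ξ) + f(ξ)² ≡ f(ξ)² modulo π
  mixed⇒quad : (U : πGAlg) {f : ∀ {k} → L k → πGAlg.A U (suc k)} →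
               IsMixedHom rawMixed U f → IsQuadHom (reduced g) (modπ U) f
  mixed⇒quad U {f} f-mixed = record
    { f-cong = f-cong~
    ; f-+    = λ x y → ~.refines (f-+ x y)
    ; f-br   = λ x y → ~.refines (f-br x y)
    ; f-P    = λ x → f x , U.move-summand (f-P₁ x) }
    where
    open IsMixedHom f-mixed
    module ~ {k} = IsCoarsening (ModPi.coarsening U k)
    module U {k} = F₂Space (IsGAlg.isVecF₂ (πGAlg.isGAlg U) k)
    f-cong~ : ∀ {k} {x y : L k} → reducedRel g x y → modπRel U (f x) (f y)
    f-cong~ {zero}        e = ~.refines (f-cong e)
    f-cong~ {suc zero}    e = ~.refines (f-cong e)
    f-cong~ {suc (suc j)} {x} {y} (z , e) =
      f z , U.trans (U.sym (f-+ x y)) (U.trans (f-cong e) (f-P>₁ z))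

  -- a quadratic homomorphism g̃ → V₊ is a mixed homomorphism g → V₊ for π = 0:
  -- it kills πg⁺, and f(Pξ) = f(ξ)² = 0·f(ξ) + f(ξ)²
  quad⇒mixed : (V : GAlg) {f : ∀ {k} → L k → GAlg.A V (suc k)} →
               IsQuadHom (reduced g) (GAlg.raw V) f → IsMixedHom rawMixed (πAsZero V) f
  quad⇒mixed V {f} f-quad = record
    { f-cong = λ e → f-cong (~.refines e)
    ; f-+    = f-+
    ; f-br   = f-br
    ; f-P₁   = λ x → V.trans (f-P x)
                       (V.trans (V.sym (V.identityˡ _)) (V.∙-congʳ (V.sym (zero-* (f x)))))
    ; f-P>₁  = λ {k} x → V.trans (f-cong {suc (suc k)} (x , G.identityʳ (P x)))
                           (V.trans f-0 (V.sym (zero-* (f x)))) }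
    where
    open IsQuadHom f-quad
    open GradedAlgebra (GAlg.raw V) (GAlg.isGAlg V)
    module ~ {k} = IsCoarsening (Reduced.coarsening g k)
    module G {k} = IsAbelianGroup (IsGradedLie.isVecF₂ isGradedLie k)
    module V {k} = F₂Space (IsGAlg.isVecF₂ (GAlg.isGAlg V) k)
    module g̃ = IsQuadLie (Reduced.isQuadLie g)
    f-0 : ∀ {k} → GAlg._≈_ V (f (0# {k})) (GAlg.0# V)
    f-0 {k} = LinearMap.h-0 (IsGradedLie.isVecF₂ g̃.isGradedLie k) (IsGAlg.isVecF₂ (GAlg.isGAlg V) _)
                f f-cong f-+

module AlgebraMaps (U : πGAlg) (V : GAlg) where
  private
    module U = πGAlg U
    module V = GAlg V
    module Uₛ {k} = F₂Space (IsGAlg.isVecF₂ U.isGAlg k)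
    module Vₛ {k} = F₂Space (IsGAlg.isVecF₂ V.isGAlg k)
    module ~ {k} = IsCoarsening (ModPi.coarsening U k)
  open GradedAlgebra V.raw V.isGAlg using (zero-*)

  -- an F₂[π]-map U → V with π ↦ 0 kills πU, hence descends to U/πU
  descend : {φ : ∀ {n} → U.A n → V.A n} →
            IsπGAlgHom U (πAsZero V) φ → IsGAlgHom (modπ U) V.raw φ
  descend {φ} φ-hom = record { φ-cong = φ-cong~ ; φ-+ = φ-+ ; φ-* = φ-* ; φ-1 = φ-1 }
    where
    open IsπGAlgHom φ-hom using (φ-π)
    open IsGAlgHom (IsπGAlgHom.isGAlgHom φ-hom)
    φ-cong~ : ∀ {n} {x y : U.A n} → modπRel U x y → φ x V.≈ φ y
    φ-cong~ {zero}  e = φ-cong e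
    φ-cong~ {suc n} {x} {y} (z , e) = Vₛ.sum≈0⇒≈ (begin
      φ x V.⊕ φ y        ≈⟨ φ-+ x y ⟨
      φ (x U.⊕ y)        ≈⟨ φ-cong e ⟩
      φ (U.π U.* z)      ≈⟨ φ-* U.π z ⟩
      φ U.π V.* φ z      ≈⟨ IsGAlg.*-cong V.isGAlg φ-π Vₛ.refl ⟩
      V.0# V.* φ z       ≈⟨ zero-* (φ z) ⟩
      V.0#               ∎)
      where open SetoidReasoning (Vₛ.setoid {suc n})

  -- an algebra map U/πU → V is an F₂[π]-map U → V with π ↦ 0, as π ∈ πU
  lift : {ψ : ∀ {n} → U.A n → V.A n} →
         IsGAlgHom (modπ U) V.raw ψ → IsπGAlgHom U (πAsZero V) ψ
  lift {ψ} ψ-hom = record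
    { isGAlgHom = record { φ-cong = λ e → φ-cong (~.refines e) ; φ-+ = φ-+ ; φ-* = φ-* ; φ-1 = φ-1 }
    ; φ-π       = Vₛ.trans (φ-cong {1} π~0) ψ-0 }
    where
    open IsGAlgHom ψ-hom
    π~0 : modπRel U U.π U.0#
    π~0 = U.1# , Uₛ.trans (Uₛ.identityʳ U.π) (Uₛ.sym (IsGAlg.*-identityʳ U.isGAlg U.π))
    ψ-0 : ψ (U.0# {1}) V.≈ V.0#
    ψ-0 = LinearMap.h-0 (IsGAlg.isVecF₂ (ModPi.isGAlgModπ U) 1) (IsGAlg.isVecF₂ V.isGAlg 1)
            ψ φ-cong φ-+

modπ-isUquad : (g : MixedLie) (U : πGAlg) (ι : ∀ {k} → MixedLie.L g k → πGAlg.A U (suc k)) →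
               IsUmix (MixedLie.rawMixed g) U ι → IsUquad (reduced g) (modπ U) ι
modπ-isUquad g U ι ι-universal = record
  { ι-hom     = mixed⇒quad U (IsUmix.ι-hom ι-universal)
  ; universal = λ V f f-quad →
      let φ , φ-hom , φ∘ι , φ-unique = IsUmix.universal ι-universal (πAsZero V) f (quad⇒mixed V f-quad)
      in  φ , AlgebraMaps.descend U V φ-hom , φ∘ι ,
          λ ψ ψ-hom ψ∘ι → φ-unique ψ (AlgebraMaps.lift U V ψ-hom) ψ∘ι }
  where open LieHomomorphisms g

proposition3p7 : (g : MixedLie) (U : πGAlg)
                 (ι : ∀ {k} → MixedLie.L g k → πGAlg.A U (suc k)) →
                 IsUmix (MixedLie.rawMixed g) U ι →
                 IsQuadLie (reduced g) × IsGAlg (modπ U) × IsUquad (reduced g) (modπ U) ι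
proposition3p7 g U ι ι-universal =
  Reduced.isQuadLie g , ModPi.isGAlgModπ U , modπ-isUquad g U ι ι-universal
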